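{- Let $S=\langle d_0,d_1,d_2,d_3\rangle$ be a numerical semigroup with embedding dimension four. Then $\mathrm{Ap}(S,d_0)$ admits a unique $L$-shape if and only if $a_{ii}=b_{ii}$ for $i=1,2,3$.
   Context: $S=\langle d_0,\dots,d_3\rangle$ is the set of nonnegative integer combinations of its minimal generators $d_0,\dots,d_3$ (with $\gcd=1$); $\mathrm{Ap}(S,d_0)=\{s\in S:s-d_0\notin S\}$. For $(i,j,k)\in\mathbb N^3$ the cube $[[i,j,k]]=[i,i+1]\times[j,j+1]\times[k,k+1]$ is labeled $id_1+jd_2+kd_3$; the initial collection is the set of all these cubes. An $L$-shape is a subset of the initial collection such that all its labels lie in $\mathrm{Ap}(S,d_0)$, every element of $\mathrm{Ap}(S,d_0)$ labels exactly one of its cubes, and whenever $[[a,b,c]]$ is not in it, no cube $[[i,j,k]]$ with $i\ge a,j\ge b,k\ge c$ is in it. For $i\in\{1,2,3\}$, $a_{ii}$ is the least positive integer with $a_{ii}d_i=\sum_{j\ne i}a_{ij}d_j$ for some $a_{ij}\in\mathbb N$, and $b_{ii}$ the least positive integer with $b_{ii}d_i=\sum_{j\ne i}b_{ij}d_j$ for some $b_{ij}\in\mathbb N$ with $b_{i0}>0$. -}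

module Defs where

open import Data.Nat using (ℕ; zero; suc; _+_; _*_; _≤_; _<_)
open import Data.Nat.GCD using (gcd)
open import Data.Fin using (Fin; zero; suc)
open import Data.Bool using (Bool; true; false)
open import Data.Product using (Σ; ∃; _×_; _,_)
open import Relation.Binary.PropositionalEquality using (_≡_; _≢_)
open import Relation.Nullary using (¬_)

Gens : Set
Gens = Fin 4 → ℕ

comb : Gens → (Fin 4 → ℕ) → ℕ
comb d c = c zero * d zero + c (suc zero) * d (suc zero)
         + c (suc (suc zero)) * d (suc (suc zero))
         + c (suc (suc (suc zero))) * d (suc (suc (suc zero)))

InS : Gens → ℕ → Set
InS d x = Σ (Fin 4 → ℕ) λ c → x ≡ comb d c

MinimalGens : Gens → Set
MinimalGens d = (i : Fin 4) →
  ¬ (Σ (Fin 4 → ℕ) λ c → (c i ≡ 0) × (d i ≡ comb d c))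

NumSemigroupEmb4 : Gens → Set
NumSemigroupEmb4 d =
  MinimalGens d ×
  gcd (gcd (d zero) (d (suc zero))) (gcd (d (suc (suc zero))) (d (suc (suc (suc zero))))) ≡ 1

InAp : Gens → ℕ → Set
InAp d s = InS d s × ¬ (Σ ℕ λ t → InS d t × (s ≡ t + d zero))

Triple : Set
Triple = ℕ × ℕ × ℕ

label : Gens → Triple → ℕ
label d (i , j , k) = i * d (suc zero) + j * d (suc (suc zero)) + k * d (suc (suc (suc zero)))

-- a subcollection of the initial collection, given by its characteristic function
Collection : Set
Collection = Triple → Bool

IsLShape : Gens → Collection → Set
IsLShape d D =
  ((p : Triple) → D p ≡ true → InAp d (label d p)) ×
  ((s : ℕ) → InAp d s → Σ Triple λ p → (D p ≡ true) × (label d p ≡ s)) ×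
  ((p q : Triple) → D p ≡ true → D q ≡ true → label d p ≡ label d q → p ≡ q) ×
  ((a b c i j k : ℕ) → D (a , b , c) ≡ false → a ≤ i → b ≤ j → c ≤ k →
     D (i , j , k) ≡ false)

UniqueLShape : Gens → Set
UniqueLShape d = Σ Collection λ D → IsLShape d D ×
  ((D' : Collection) → IsLShape d D' → (p : Triple) → D' p ≡ D p)

IsARel : Gens → Fin 4 → ℕ → Set
IsARel d i n = (0 < n) × Σ (Fin 4 → ℕ) λ c → (c i ≡ 0) × (n * d i ≡ comb d c)

IsBRel : Gens → Fin 4 → ℕ → Set
IsBRel d i n = (0 < n) × Σ (Fin 4 → ℕ) λ c → (c i ≡ 0) × (0 < c zero) × (n * d i ≡ comb d c)

IsLeast : (ℕ → Set) → ℕ → Set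
IsLeast P n = P n × ((m : ℕ) → P m → n ≤ m)

AEqualsB : Gens → Set
AEqualsB d = (i : Fin 4) → i ≢ zero → (a b : ℕ) →
  IsLeast (IsARel d i) a → IsLeast (IsBRel d i) b → a ≡ b

-- Among the representations of an element of Ap(S,d₀) as a label, the least one
-- for a monomial order ≺ on ℕ³ always gives an L-shape, so the L-shape is unique
-- exactly when every element of Ap(S,d₀) has a single representation.
--
-- If aᵢᵢ = bᵢᵢ, a minimal relation aᵢᵢdᵢ = Σⱼ bᵢⱼdⱼ involves d₀, hence x·dᵢ − d₀ ∈ S
-- whenever x·dᵢ is a combination of the other generators. Two representations of an
-- Apéry element reduce, after cancelling common generators, to such an equation
-- x·dᵢ = Σ_{j≠0,i} cⱼdⱼ, which is impossible in Ap(S,d₀).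
-- Conversely, if aᵢᵢ < bᵢᵢ, then aᵢᵢdᵢ lies in Ap(S,d₀) and has a second
-- representation without dᵢ; the lexicographic orders comparing the i-th
-- coordinate first and last choose different ones.

module Submission where

open import Defs
open import Function.Bundles using (_⇔_; mk⇔)
open import Function.Properties.Equivalence using () renaming (sym to ⇔-sym; trans to ⇔-trans)
open import Function.Base using (_∘_; const)
open import Function.Definitions using (Injective)
open import Level using (0ℓ)
open import Data.Nat using (ℕ; zero; suc; pred; _+_; _*_; _∸_; _≤_; _<_; s≤s; z<s; _≟_; _<?_; _≤?_; >-nonZero)
open import Data.Nat.Properties
open import Algebra.Properties.CommutativeSemigroup +-commutativeSemigroup using (xy∙z≈xz∙y)
open import Data.Nat.Tactic.RingSolver using (solve-∀)
open import Data.Nat.Induction using (<-wellFounded)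
open import Data.Fin using (Fin; zero; suc; toℕ; #_)
open import Data.Bool using (true; false)
open import Data.Bool.Properties using (⇔→≡)
open import Data.Product using (Σ; ∃; _×_; _,_; proj₁; proj₂)
open import Data.Product.Relation.Binary.Lex.Strict using (×-Lex; ×-wellFounded; ×-decidable; ×-compare)
open import Data.Sum using (inj₁; inj₂)
open import Data.Vec.Functional using (Vector; _∷_; []; head; tail; updateAt; zipWith)
open import Data.Vec.Functional.Properties using (updateAt-updates)
open import Induction.WellFounded using (WellFounded; Acc; acc)
import Relation.Binary.Construct.On as On
open import Relation.Binary.Core using (Rel)
open import Relation.Binary.Definitions using (Decidable; Trichotomous; tri<; tri≈; tri>)
open import Relation.Binary.PropositionalEquality
open import Relation.Nullary using (¬_; Dec; yes; no; does; contradiction)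
open import Relation.Nullary.Decidable using (map′; _×-dec_; ¬?; dec-true; dec-false)

dec-true⁻¹ : ∀ {A : Set} (a? : Dec A) → does a? ≡ true → A
dec-true⁻¹ (yes a) _ = a

least : {P : ℕ → Set} → (∀ n → Dec (P n)) → ∀ {x} → P x → ∃ (IsLeast P)
least {P} P? {x} = go (<-wellFounded x)
  where
  go : ∀ {x} → Acc _<_ x → P x → ∃ (IsLeast P)
  go {x} (acc below) px with anyUpTo? P? x
  ... | yes (n , n<x , pn) = go (below n<x) pn
  ... | no none            = x , px , λ m pm → ≮⇒≥ λ m<x → none (m , m<x , pm)

∃-bounded? : ∀ {n} x {Q : Vector ℕ n → Set} → (∀ c → Dec (Q c)) →
             (∀ {c c′} → (∀ j → c j ≡ c′ j) → Q c → Q c′) →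
             (∀ c → Q c → ∀ j → c j ≤ x) → Dec (∃ Q)
∃-bounded? {zero} x Q? resp bound = map′ ([] ,_) (λ (c , q) → resp (λ ()) q) (Q? [])
∃-bounded? {suc n} x {Q} Q? resp bound =
  map′ (λ (h , _ , c , q) → h ∷ c , q)
       (λ (c , q) → head c , s≤s (bound c q zero) , tail c , resp head∷tail q)
       (anyUpTo? (λ h → ∃-bounded? x (Q? ∘ (h ∷_)) (resp ∘ ∷-cong) (λ c q → bound _ q ∘ suc)) (suc x))
  where
  head∷tail : ∀ {c : Vector ℕ (suc n)} j → c j ≡ (head c ∷ tail c) j
  head∷tail zero    = refl
  head∷tail (suc j) = refl
  ∷-cong : ∀ {h} {c c′ : Vector ℕ n} → (∀ j → c j ≡ c′ j) → ∀ j → (h ∷ c) j ≡ (h ∷ c′) j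
  ∷-cong e zero    = refl
  ∷-cong e (suc j) = e j

infixl 6 _⊕_

_⊕_ : Triple → Triple → Triple
(a , b , c) ⊕ (a′ , b′ , c′) = a + a′ , b + b′ , c + c′

unit : Fin 3 → ℕ → Triple
unit zero             x = x , 0 , 0
unit (suc zero)       x = 0 , x , 0
unit (suc (suc zero)) x = 0 , 0 , x

toVec : Triple → Vector ℕ 3
toVec (a , b , c) = a ∷ b ∷ c ∷ []

fromVec : Vector ℕ 3 → Triple
fromVec v = v (# 0) , v (# 1) , v (# 2)

fromVec-cong : ∀ {v v′} → (∀ j → v j ≡ v′ j) → fromVec v ≡ fromVec v′
fromVec-cong e = cong₂ _,_ (e (# 0)) (cong₂ _,_ (e (# 1)) (e (# 2)))

-- label d p is definitionally comb d (toCoeffs p).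
toCoeffs : Triple → Vector ℕ 4
toCoeffs p = 0 ∷ toVec p

fromCoeffs : Vector ℕ 4 → Triple
fromCoeffs c = fromVec (tail c)

toCoeffs-fromCoeffs : ∀ c i → toCoeffs (fromCoeffs c) (suc i) ≡ c (suc i)
toCoeffs-fromCoeffs c zero             = refl
toCoeffs-fromCoeffs c (suc zero)       = refl
toCoeffs-fromCoeffs c (suc (suc zero)) = refl

record MonomialOrder : Set₁ where
  infix 4 _≺_ _≺?_
  field
    _≺_           : Rel Triple 0ℓ
    _≺?_          : Decidable _≺_
    ≺-wellFounded : WellFounded _≺_
    ≺-compare     : Trichotomous _≡_ _≺_
    ≺-+           : ∀ r {p q} → p ≺ q → r ⊕ p ≺ r ⊕ q

infix 4 _<ₗₑₓ_

_<ₗₑₓ_ : Rel Triple 0ℓ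
_<ₗₑₓ_ = ×-Lex _≡_ _<_ (×-Lex _≡_ _<_ _<_)

lex : MonomialOrder
lex = record
  { _≺_           = _<ₗₑₓ_
  ; _≺?_          = ×-decidable _≟_ _<?_ (×-decidable _≟_ _<?_ _<?_)
  ; ≺-wellFounded = ×-wellFounded <-wellFounded (×-wellFounded <-wellFounded <-wellFounded)
  ; ≺-compare     = compare
  ; ≺-+           = translate
  }
  where
  compare : Trichotomous _≡_ _<ₗₑₓ_
  compare p@(_ , _ , _) q@(_ , _ , _)
    with ×-compare sym <-cmp (×-compare sym <-cmp <-cmp) p q
  ... | tri< lt ¬eq ¬gt = tri< lt (λ { refl → ¬eq (refl , refl , refl) }) ¬gt
  ... | tri≈ ¬lt (refl , refl , refl) ¬gt = tri≈ ¬lt refl ¬gt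
  ... | tri> ¬lt ¬eq gt = tri> ¬lt (λ { refl → ¬eq (refl , refl , refl) }) gt

  translate : ∀ r {p q} → p <ₗₑₓ q → r ⊕ p <ₗₑₓ r ⊕ q
  translate (x , _ , _) (inj₁ lt)                       = inj₁ (+-monoʳ-< x lt)
  translate (_ , y , _) (inj₂ (refl , inj₁ lt))         = inj₂ (refl , inj₁ (+-monoʳ-< y lt))
  translate (_ , _ , z) (inj₂ (refl , inj₂ (refl , lt))) = inj₂ (refl , inj₂ (refl , +-monoʳ-< z lt))

pullback : (σ : Triple → Triple) → Injective _≡_ _≡_ σ → (∀ p q → σ (p ⊕ q) ≡ σ p ⊕ σ q) →
           MonomialOrder → MonomialOrder
pullback σ σ-injective σ-⊕ O = record
  { _≺_           = λ p q → σ p ≺ σ q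
  ; _≺?_          = λ p q → σ p ≺? σ q
  ; ≺-wellFounded = On.wellFounded σ ≺-wellFounded
  ; ≺-compare     = compare
  ; ≺-+           = λ r {p} {q} σp≺σq → subst₂ _≺_ (sym (σ-⊕ r p)) (sym (σ-⊕ r q)) (≺-+ (σ r) σp≺σq)
  }
  where
  open MonomialOrder O
  compare : Trichotomous _≡_ (λ p q → σ p ≺ σ q)
  compare p q with ≺-compare (σ p) (σ q)
  ... | tri< lt ¬eq ¬gt = tri< lt (¬eq ∘ cong σ) ¬gt
  ... | tri≈ ¬lt eq ¬gt = tri≈ ¬lt (σ-injective eq) ¬gt
  ... | tri> ¬lt ¬eq gt = tri> ¬lt (¬eq ∘ cong σ) gt

rotate : Triple → Triple
rotate (a , b , c) = b , c , a

rotate-injective : Injective _≡_ _≡_ rotate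
rotate-injective refl = refl

lexRotated : ℕ → MonomialOrder
lexRotated zero    = lex
lexRotated (suc k) = pullback rotate rotate-injective (λ _ _ → refl) (lexRotated k)

-- Lexicographic orders in which the i-th coordinate is compared first, resp. last.
firstOrder lastOrder : Fin 3 → MonomialOrder
firstOrder i = lexRotated (toℕ i)
lastOrder  i = lexRotated (suc (toℕ i))

≺-first-unit : ∀ i {x} q → toCoeffs q (suc i) ≡ 0 → 0 < x → MonomialOrder._≺_ (firstOrder i) q (unit i x)
≺-first-unit zero             (_ , _ , _) refl 0<x = inj₁ 0<x
≺-first-unit (suc zero)       (_ , _ , _) refl 0<x = inj₁ 0<x
≺-first-unit (suc (suc zero)) (_ , _ , _) refl 0<x = inj₁ 0<x

≺-last-unit : ∀ i {x} q → MonomialOrder._≺_ (lastOrder i) q (unit i x) → ∃ λ y → y < x × q ≡ unit i y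
≺-last-unit zero             (y , _ , _) (inj₂ (refl , inj₂ (refl , y<x))) = y , y<x , refl
≺-last-unit (suc zero)       (_ , y , _) (inj₂ (refl , inj₂ (refl , y<x))) = y , y<x , refl
≺-last-unit (suc (suc zero)) (_ , _ , y) (inj₂ (refl , inj₂ (refl , y<x))) = y , y<x , refl

minimalGens⇒positive : ∀ {d} → MinimalGens d → ∀ j → 0 < d j
minimalGens⇒positive {d} minimal j with d j in dⱼ≡0
... | zero  = contradiction (const 0 , refl , dⱼ≡0) (minimal j)
... | suc _ = z<s

multiple-split : ∀ {a x} v → a ≤ x → x * v ≡ (x ∸ a) * v + a * v
multiple-split {a} {x} v a≤x = trans (cong (_* v) (sym (m∸n+n≡m a≤x))) (*-distribʳ-+ v (x ∸ a) a)

private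
  exchange₀ : ∀ x t₀ t₁ t₂ t₃ → x + t₁ + t₂ + t₃ + t₀ ≡ t₀ + t₁ + t₂ + t₃ + x
  exchange₀ = solve-∀
  exchange₁ : ∀ x t₀ t₁ t₂ t₃ → t₀ + x + t₂ + t₃ + t₁ ≡ t₀ + t₁ + t₂ + t₃ + x
  exchange₁ = solve-∀
  exchange₂ : ∀ x t₀ t₁ t₂ t₃ → t₀ + t₁ + x + t₃ + t₂ ≡ t₀ + t₁ + t₂ + t₃ + x
  exchange₂ = solve-∀
  exchange₃ : ∀ x t₀ t₁ t₂ t₃ → t₀ + t₁ + t₂ + x + t₃ ≡ t₀ + t₁ + t₂ + t₃ + x
  exchange₃ = solve-∀

module _ (d : Gens) (d-pos : ∀ j → 0 < d j) where

  comb-cong : ∀ {c c′} → (∀ j → c j ≡ c′ j) → comb d c ≡ comb d c′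
  comb-cong e rewrite e (# 0) | e (# 1) | e (# 2) | e (# 3) = refl

  comb-+ : ∀ c c′ → comb d (zipWith _+_ c c′) ≡ comb d c + comb d c′
  comb-+ c c′ = distrib (c (# 0)) (c (# 1)) (c (# 2)) (c (# 3)) (c′ (# 0)) (c′ (# 1)) (c′ (# 2)) (c′ (# 3))
                        (d (# 0)) (d (# 1)) (d (# 2)) (d (# 3))
    where
    distrib : ∀ a b c e a′ b′ c′ e′ x y z w →
      (a + a′) * x + (b + b′) * y + (c + c′) * z + (e + e′) * w
        ≡ (a * x + b * y + c * z + e * w) + (a′ * x + b′ * y + c′ * z + e′ * w)
    distrib = solve-∀

  comb-updateAt : ∀ c j v → comb d (updateAt c j (const v)) + c j * d j ≡ comb d c + v * d j
  comb-updateAt c j v = exchange j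
    where
    t : Vector ℕ 4
    t k = c k * d k
    exchange : ∀ j → comb d (updateAt c j (const v)) + c j * d j ≡ comb d c + v * d j
    exchange zero                   = exchange₀ (v * d (# 0)) (t (# 0)) (t (# 1)) (t (# 2)) (t (# 3))
    exchange (suc zero)             = exchange₁ (v * d (# 1)) (t (# 0)) (t (# 1)) (t (# 2)) (t (# 3))
    exchange (suc (suc zero))       = exchange₂ (v * d (# 2)) (t (# 0)) (t (# 1)) (t (# 2)) (t (# 3))
    exchange (suc (suc (suc zero))) = exchange₃ (v * d (# 3)) (t (# 0)) (t (# 1)) (t (# 2)) (t (# 3))

  comb-remove : ∀ c j → comb d c ≡ comb d (updateAt c j (const 0)) + c j * d j
  comb-remove c j = sym (trans (comb-updateAt c j 0) (+-identityʳ _))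

  comb-single : ∀ j k → comb d (updateAt (const 0) j (const k)) ≡ k * d j
  comb-single j k = trans (sym (+-identityʳ _)) (comb-updateAt (const 0) j k)

  coeff≤ : ∀ {s} c → s ≡ comb d c → ∀ j → c j ≤ s
  coeff≤ c refl j = begin
    c j                                       ≤⟨ m≤m*n (c j) (d j) {{>-nonZero (d-pos j)}} ⟩
    c j * d j                                 ≤⟨ m≤n+m _ _ ⟩
    comb d (updateAt c j (const 0)) + c j * d j ≡⟨ comb-remove c j ⟨
    comb d c                                  ∎
    where open ≤-Reasoning

  label-⊕ : ∀ p q → label d (p ⊕ q) ≡ label d p + label d q
  label-⊕ p q = comb-+ (toCoeffs p) (toCoeffs q)

  label-⊕-cong : ∀ r {p q} → label d p ≡ label d q → label d (r ⊕ p) ≡ label d (r ⊕ q)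
  label-⊕-cong r {p} {q} e = trans (label-⊕ r p) (trans (cong (label d r +_) e) (sym (label-⊕ r q)))

  label-⊕-cancel : ∀ r p q → label d (r ⊕ p) ≡ label d (r ⊕ q) → label d p ≡ label d q
  label-⊕-cancel r p q e = +-cancelˡ-≡ (label d r) _ _ (trans (sym (label-⊕ r p)) (trans e (label-⊕ r q)))

  label-unit : ∀ i x → label d (unit i x) ≡ x * d (suc i)
  label-unit zero             x = trans (+-identityʳ _) (+-identityʳ _)
  label-unit (suc zero)       x = +-identityʳ _
  label-unit (suc (suc zero)) x = refl

  label-fromCoeffs : ∀ c → c zero ≡ 0 → label d (fromCoeffs c) ≡ comb d c
  label-fromCoeffs c c₀≡0 rewrite c₀≡0 = refl

  label≡0 : ∀ p → label d p ≡ 0 → p ≡ (0 , 0 , 0)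
  label≡0 p e = fromVec-cong λ j → n≤0⇒n≡0 (coeff≤ (toCoeffs p) (sym e) (suc j))

  InS-+ : ∀ {u v} → InS d u → InS d v → InS d (u + v)
  InS-+ (c , refl) (c′ , refl) = zipWith _+_ c c′ , sym (comb-+ c c′)

  InS-multiple : ∀ j k → InS d (k * d j)
  InS-multiple j k = updateAt (const 0) j (const k) , sym (comb-single j k)

  InS-label : ∀ p → InS d (label d p)
  InS-label p = toCoeffs p , refl

  -- InAp d s unfolds to InS d s × ¬ Reducible s.
  Reducible : ℕ → Set
  Reducible s = Σ ℕ λ t → InS d t × (s ≡ t + d zero)

  reducible-+ˡ : ∀ {u s} → InS d u → Reducible s → Reducible (u + s)
  reducible-+ˡ {u} uS (t , tS , refl) = u + t , InS-+ uS tS , sym (+-assoc u t (d zero))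

  comb-reducible : ∀ c → 0 < c zero → Reducible (comb d c)
  comb-reducible c 0<c₀ = comb d c′ , (c′ , refl) , +-cancelʳ-≡ (m * d zero) _ _ (begin
    comb d c + m * d zero              ≡⟨ comb-updateAt c zero m ⟨
    comb d c′ + c zero * d zero        ≡⟨ cong (λ k → comb d c′ + k * d zero) (suc-pred (c zero) {{>-nonZero 0<c₀}}) ⟨
    comb d c′ + (d zero + m * d zero)  ≡⟨ +-assoc (comb d c′) (d zero) (m * d zero) ⟨
    comb d c′ + d zero + m * d zero    ∎)
    where
    open ≡-Reasoning
    m  = pred (c zero)
    c′ = updateAt c zero (const m)

  InAp-⊕ : ∀ r p → InAp d (label d (r ⊕ p)) → InAp d (label d p)
  InAp-⊕ r p (_ , irreducible) =
    InS-label p , irreducible ∘ subst Reducible (sym (label-⊕ r p)) ∘ reducible-+ˡ (InS-label r)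

  InAp⇒label : ∀ {s} → InAp d s → ∃ λ p → label d p ≡ s
  InAp⇒label ((c , refl) , irreducible) with c zero ≟ 0
  ... | yes c₀≡0 = fromCoeffs c , label-fromCoeffs c c₀≡0
  ... | no  c₀≢0 = contradiction (comb-reducible c (n≢0⇒n>0 c₀≢0)) irreducible

  InS? : ∀ s → Dec (InS d s)
  InS? s = ∃-bounded? s (λ c → s ≟ comb d c) (λ e s≡c → trans s≡c (comb-cong e)) coeff≤

  Reducible? : ∀ s → Dec (Reducible s)
  Reducible? s with d zero ≤? s
  ... | no  d₀≰s = no λ (t , _ , s≡t+d₀) → d₀≰s (subst (d zero ≤_) (sym s≡t+d₀) (m≤n+m (d zero) t))
  ... | yes d₀≤s = map′ (λ tS → s ∸ d zero , tS , sym (m∸n+n≡m d₀≤s))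
                        (λ (t , tS , s≡t+d₀) →
                           subst (InS d) (sym (trans (cong (_∸ d zero) s≡t+d₀) (m+n∸n≡m t (d zero)))) tS)
                        (InS? (s ∸ d zero))

  InAp? : ∀ s → Dec (InAp d s)
  InAp? s = InS? s ×-dec ¬? (Reducible? s)

  IsARel? : ∀ i n → Dec (IsARel d i n)
  IsARel? i n = 0 <? n ×-dec ∃-bounded? (n * d i)
    (λ c → c i ≟ 0 ×-dec n * d i ≟ comb d c)
    (λ e (cᵢ≡0 , eq) → trans (sym (e i)) cᵢ≡0 , trans eq (comb-cong e))
    (λ c (_ , eq) → coeff≤ c eq)

  IsBRel? : ∀ i n → Dec (IsBRel d i n)
  IsBRel? i n = 0 <? n ×-dec ∃-bounded? (n * d i)
    (λ c → c i ≟ 0 ×-dec 0 <? c zero ×-dec n * d i ≟ comb d c)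
    (λ e (cᵢ≡0 , 0<c₀ , eq) → trans (sym (e i)) cᵢ≡0 , subst (0 <_) (e zero) 0<c₀ , trans eq (comb-cong e))
    (λ c (_ , _ , eq) → coeff≤ c eq)

  module Shape (O : MonomialOrder) where
    open MonomialOrder O

    HasSmallerRep : Triple → Set
    HasSmallerRep p = ∃ λ q → label d q ≡ label d p × q ≺ p

    hasSmallerRep? : ∀ p → Dec (HasSmallerRep p)
    hasSmallerRep? p = map′ (λ (v , h) → fromVec v , h) (λ (q , h) → toVec q , h)
      (∃-bounded? (label d p)
        (λ v → label d (fromVec v) ≟ label d p ×-dec fromVec v ≺? p)
        (λ e → subst (λ q → label d q ≡ label d p × q ≺ p) (fromVec-cong e))
        (λ v (eq , _) j → coeff≤ (0 ∷ v) (sym eq) (suc j)))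

    Normal : Triple → Set
    Normal p = InAp d (label d p) × ¬ HasSmallerRep p

    normal? : ∀ p → Dec (Normal p)
    normal? p = InAp? (label d p) ×-dec ¬? (hasSmallerRep? p)

    D : Collection
    D p = does (normal? p)

    normal⇒D : ∀ p → Normal p → D p ≡ true
    normal⇒D p = dec-true (normal? p)

    D⇒normal : ∀ p → D p ≡ true → Normal p
    D⇒normal p = dec-true⁻¹ (normal? p)

    normal-rep : ∀ {s} → InAp d s → ∃ λ p → Normal p × label d p ≡ s
    normal-rep {s} ap = let p , lp≡s = InAp⇒label ap in descend p (≺-wellFounded p) lp≡s
      where
      descend : ∀ p → Acc _≺_ p → label d p ≡ s → ∃ λ p → Normal p × label d p ≡ s
      descend p (acc smaller) lp≡s with hasSmallerRep? p
      ... | yes (q , lq≡lp , q≺p) = descend q (smaller q≺p) (trans lq≡lp lp≡s)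
      ... | no  minimal           = p , (subst (InAp d) (sym lp≡s) ap , minimal) , lp≡s

    normal-unique : ∀ {p q} → Normal p → Normal q → label d p ≡ label d q → p ≡ q
    normal-unique {p} {q} (_ , p-minimal) (_ , q-minimal) lp≡lq with ≺-compare p q
    ... | tri< p≺q _ _ = contradiction (p , lp≡lq , p≺q) q-minimal
    ... | tri≈ _ p≡q _ = p≡q
    ... | tri> _ _ q≺p = contradiction (q , sym lp≡lq , q≺p) p-minimal

    normal-⊕ : ∀ r p → Normal (r ⊕ p) → Normal p
    normal-⊕ r p (ap , minimal) =
      InAp-⊕ r p ap , λ (q , lq≡lp , q≺p) → minimal (r ⊕ q , label-⊕-cong r lq≡lp , ≺-+ r q≺p)

    D-downClosed : ∀ a b c i j k → D (a , b , c) ≡ false → a ≤ i → b ≤ j → c ≤ k → D (i , j , k) ≡ false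
    D-downClosed a b c i j k Dabc≡false a≤i b≤j c≤k = dec-false (normal? (i , j , k)) λ normal →
      contradiction (trans (sym (normal⇒D (a , b , c) (normal-⊕ r (a , b , c) (subst Normal ijk≡r⊕abc normal)))) Dabc≡false) λ ()
      where
      r = i ∸ a , j ∸ b , k ∸ c
      ijk≡r⊕abc : (i , j , k) ≡ r ⊕ (a , b , c)
      ijk≡r⊕abc = sym (cong₂ _,_ (m∸n+n≡m a≤i) (cong₂ _,_ (m∸n+n≡m b≤j) (m∸n+n≡m c≤k)))

    isLShape : IsLShape d D
    isLShape = (λ p → proj₁ ∘ D⇒normal p)
             , (λ s ap → let p , normal , lp≡s = normal-rep ap in p , normal⇒D p normal , lp≡s)
             , (λ p q Dp Dq → normal-unique (D⇒normal p Dp) (D⇒normal q Dq))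
             , D-downClosed

  B⇒A : ∀ {i n} → IsBRel d i n → IsARel d i n
  B⇒A (0<n , c , cᵢ≡0 , _ , eq) = 0<n , c , cᵢ≡0 , eq

  B-reducible : ∀ {i n} → IsBRel d i n → Reducible (n * d i)
  B-reducible (_ , c , _ , 0<c₀ , eq) = subst Reducible (sym eq) (comb-reducible c 0<c₀)

  B-exists : ∀ i → IsBRel d (suc i) (d zero)
  B-exists i = d-pos zero , updateAt (const 0) zero (const (d (suc i))) , refl , d-pos (suc i) ,
               trans (*-comm (d zero) (d (suc i))) (sym (comb-single zero (d (suc i))))

  -- With a ≡ b, the least A-relation a·dᵢ can be taken to involve d₀.
  AEqualsB⇒A-reducible : AEqualsB d → ∀ i {x} → IsARel d (suc i) x → Reducible (x * d (suc i))
  AEqualsB⇒A-reducible aEqualsB i {x} xA =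
    let a , aLeast = least (IsARel? (suc i)) xA
        b , bLeast = least (IsBRel? (suc i)) (B-exists i)
        a≡b = aEqualsB (suc i) (λ ()) a b aLeast bLeast
        a≤x = proj₂ aLeast x xA
    in subst Reducible (sym (multiple-split (d (suc i)) a≤x))
         (reducible-+ˡ (InS-multiple (suc i) (x ∸ a))
           (subst (λ n → Reducible (n * d (suc i))) (sym a≡b) (B-reducible (proj₁ bLeast))))

  UniqueReps : Set
  UniqueReps = ∀ p q → label d p ≡ label d q → InAp d (label d p) → p ≡ q

  AEqualsB⇒unit∉Ap : AEqualsB d → ∀ i x q → 0 < x → toCoeffs q (suc i) ≡ 0 →
                     label d q ≡ label d (unit i x) → ¬ InAp d (label d q)
  AEqualsB⇒unit∉Ap aEqualsB i x q 0<x qᵢ≡0 lq≡ (_ , irreducible) =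
    irreducible (subst Reducible (sym (trans lq≡ (label-unit i x)))
      (AEqualsB⇒A-reducible aEqualsB i (0<x , toCoeffs q , qᵢ≡0 , sym (trans lq≡ (label-unit i x)))))

  -- Cancel common generators; what remains are two representations with
  -- disjoint supports, one of which is a multiple of a single generator.
  AEqualsB⇒uniqueReps : AEqualsB d → UniqueReps
  AEqualsB⇒uniqueReps aEqualsB = unique
    where
    unit∉Ap = AEqualsB⇒unit∉Ap aEqualsB

    cancel : ∀ i {p q} → label d (unit i 1 ⊕ p) ≡ label d (unit i 1 ⊕ q) →
             InAp d (label d (unit i 1 ⊕ p)) → p ≡ q
    unique : UniqueReps

    cancel i {p} {q} lp≡lq ap = unique p q (label-⊕-cancel (unit i 1) p q lp≡lq) (InAp-⊕ (unit i 1) p ap)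

    unique (suc _ , _ , _) (suc _ , _ , _) e ap = cong (unit (# 0) 1 ⊕_) (cancel (# 0) e ap)
    unique (_ , suc _ , _) (_ , suc _ , _) e ap = cong (unit (# 1) 1 ⊕_) (cancel (# 1) e ap)
    unique (_ , _ , suc _) (_ , _ , suc _) e ap = cong (unit (# 2) 1 ⊕_) (cancel (# 2) e ap)
    unique (zero , zero , zero) q e _ = sym (label≡0 q (sym e))
    unique p (zero , zero , zero) e _ = label≡0 p e
    unique (suc a , zero , zero) q@(zero , _ , _) e ap =
      contradiction (subst (InAp d) e ap) (unit∉Ap (# 0) (suc a) q z<s refl (sym e))
    unique (zero , suc b , zero) q@(_ , zero , _) e ap =
      contradiction (subst (InAp d) e ap) (unit∉Ap (# 1) (suc b) q z<s refl (sym e))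
    unique (zero , zero , suc c) q@(_ , _ , zero) e ap =
      contradiction (subst (InAp d) e ap) (unit∉Ap (# 2) (suc c) q z<s refl (sym e))
    unique p@(suc _ , suc _ , zero) (zero , zero , suc c) e ap =
      contradiction ap (unit∉Ap (# 2) (suc c) p z<s refl e)
    unique p@(suc _ , zero , suc _) (zero , suc b , zero) e ap =
      contradiction ap (unit∉Ap (# 1) (suc b) p z<s refl e)
    unique p@(zero , suc _ , suc _) (suc a , zero , zero) e ap =
      contradiction ap (unit∉Ap (# 0) (suc a) p z<s refl e)

  uniqueReps⇒member : UniqueReps → ∀ {D} → IsLShape d D → ∀ p → D p ≡ true ⇔ InAp d (label d p)
  uniqueReps⇒member unique {D} (inAp , covers , _ , _) p = mk⇔ (inAp p) λ ap →
    let q , Dq , lq≡lp = covers (label d p) ap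
    in subst (λ r → D r ≡ true) (unique q p lq≡lp (subst (InAp d) (sym lq≡lp) ap)) Dq

  uniqueReps⇒LShapes-agree : UniqueReps → ∀ {D D′} → IsLShape d D → IsLShape d D′ → ∀ p → D′ p ≡ D p
  uniqueReps⇒LShapes-agree unique isLShape isLShape′ p = ⇔→≡ {z = true}
    (⇔-trans (uniqueReps⇒member unique isLShape′ p) (⇔-sym (uniqueReps⇒member unique isLShape p)))

  AEqualsB⇒uniqueLShape : AEqualsB d → UniqueLShape d
  AEqualsB⇒uniqueLShape aEqualsB =
    D , isLShape , λ _ → uniqueReps⇒LShapes-agree (AEqualsB⇒uniqueReps aEqualsB) isLShape
    where open Shape lex

  B-from-reducible : ∀ i {n} e → 0 < n → e (suc i) ≡ 0 → n * d (suc i) ≡ comb d e + d zero → IsBRel d (suc i) n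
  B-from-reducible i {n} e 0<n eᵢ≡0 eq = 0<n , c , eᵢ≡0 , z<s , trans eq (sym comb-c)
    where
    c = updateAt e zero (const (suc (e zero)))
    comb-c : comb d c ≡ comb d e + d zero
    comb-c = +-cancelʳ-≡ (e zero * d zero) _ _ (begin
      comb d c + e zero * d zero            ≡⟨ comb-updateAt e zero (suc (e zero)) ⟩
      comb d e + (d zero + e zero * d zero) ≡⟨ +-assoc (comb d e) (d zero) (e zero * d zero) ⟨
      comb d e + d zero + e zero * d zero   ∎)
      where open ≡-Reasoning

  -- If aᵢᵢ < bᵢᵢ, then aᵢᵢ·dᵢ − d₀ ∈ S would give a B-relation for a multiple of dᵢ below aᵢᵢ.
  A<B⇒irreducible : ∀ i {a b} → IsLeast (IsBRel d (suc i)) b → a < b → ¬ Reducible (a * d (suc i))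
  A<B⇒irreducible i {a} {b} (_ , b-least) a<b (t , (e , refl) , adᵢ≡) with a ≤? e (suc i)
  ... | yes a≤eᵢ = <-irrefl refl (begin-strict
    a * d (suc i)                                                 ≤⟨ *-monoˡ-≤ (d (suc i)) a≤eᵢ ⟩
    e (suc i) * d (suc i)                                         ≤⟨ m≤n+m _ _ ⟩
    comb d (updateAt e (suc i) (const 0)) + e (suc i) * d (suc i) ≡⟨ comb-remove e (suc i) ⟨
    comb d e                                                      <⟨ m<m+n _ (d-pos zero) ⟩
    comb d e + d zero                                             ≡⟨ adᵢ≡ ⟨
    a * d (suc i)                                                 ∎)
    where open ≤-Reasoning
  ... | no a≰eᵢ = <⇒≱ a<b (≤-trans (b-least n nB) (m∸n≤m a (e (suc i))))
    where
    open ≡-Reasoning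
    eᵢ<a = ≰⇒> a≰eᵢ
    n    = a ∸ e (suc i)
    e′   = updateAt e (suc i) (const 0)
    nB : IsBRel d (suc i) n
    nB = B-from-reducible i e′ (m<n⇒0<n∸m eᵢ<a) (updateAt-updates (suc i) e) ndᵢ≡
      where
      ndᵢ≡ : n * d (suc i) ≡ comb d e′ + d zero
      ndᵢ≡ = +-cancelʳ-≡ (e (suc i) * d (suc i)) _ _ (begin
        n * d (suc i) + e (suc i) * d (suc i)      ≡⟨ multiple-split (d (suc i)) (<⇒≤ eᵢ<a) ⟨
        a * d (suc i)                              ≡⟨ adᵢ≡ ⟩
        comb d e + d zero                          ≡⟨ cong (_+ d zero) (comb-remove e (suc i)) ⟩
        comb d e′ + e (suc i) * d (suc i) + d zero ≡⟨ xy∙z≈xz∙y (comb d e′) _ _ ⟩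
        comb d e′ + d zero + e (suc i) * d (suc i) ∎)

  unit-notNormal-first : ∀ i {x} q → 0 < x → toCoeffs q (suc i) ≡ 0 → label d q ≡ label d (unit i x) →
                         ¬ Shape.Normal (firstOrder i) (unit i x)
  unit-notNormal-first i q 0<x qᵢ≡0 lq≡lu (_ , minimal) = minimal (q , lq≡lu , ≺-first-unit i q qᵢ≡0 0<x)

  unit-normal-last : ∀ i {x} → InAp d (label d (unit i x)) → Shape.Normal (lastOrder i) (unit i x)
  unit-normal-last i {x} ap = ap , λ (q , lq≡lu , q≺u) → below-unit (≺-last-unit i q q≺u) lq≡lu
    where
    below-unit : ∀ {q} → (∃ λ y → y < x × q ≡ unit i y) → label d q ≢ label d (unit i x)
    below-unit (y , y<x , refl) = <⇒≢ (subst₂ _<_ (sym (label-unit i y)) (sym (label-unit i x))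
                                         (*-monoˡ-< (d (suc i)) {{>-nonZero (d-pos (suc i))}} y<x))

  -- The order comparing coordinate i first prefers q, the one comparing it last prefers x·eᵢ.
  twoReps⇒¬uniqueLShape : ∀ i {x} q → 0 < x → toCoeffs q (suc i) ≡ 0 → label d q ≡ label d (unit i x) →
                          InAp d (label d (unit i x)) → ¬ UniqueLShape d
  twoReps⇒¬uniqueLShape i {x} q 0<x qᵢ≡0 lq≡lu ap (D , _ , unique) = contradiction (begin
    false      ≡⟨ dec-false (First.normal? u) (unit-notNormal-first i q 0<x qᵢ≡0 lq≡lu) ⟨
    First.D u  ≡⟨ unique First.D First.isLShape u ⟩
    D u        ≡⟨ unique Last.D Last.isLShape u ⟨
    Last.D u   ≡⟨ dec-true (Last.normal? u) (unit-normal-last i ap) ⟩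
    true       ∎) λ ()
    where
    open ≡-Reasoning
    u = unit i x
    module First = Shape (firstOrder i)
    module Last  = Shape (lastOrder i)

  uniqueLShape⇒AEqualsB : UniqueLShape d → AEqualsB d
  uniqueLShape⇒AEqualsB _ zero 0≢0 = contradiction refl 0≢0
  uniqueLShape⇒AEqualsB uniqueLShape (suc i) _ a b aLeast bLeast =
    ≤-antisym (proj₂ aLeast b (B⇒A (proj₁ bLeast))) (≮⇒≥ a≮b)
    where
    a≮b : ¬ a < b
    a≮b a<b with proj₁ aLeast
    ... | 0<a , c , cᵢ≡0 , adᵢ≡c with c zero ≟ 0
    ...   | no c₀≢0  = <⇒≱ a<b (proj₂ bLeast a (0<a , c , cᵢ≡0 , n≢0⇒n>0 c₀≢0 , adᵢ≡c))
    ...   | yes c₀≡0 = twoReps⇒¬uniqueLShape i (fromCoeffs c) 0<a (trans (toCoeffs-fromCoeffs c i) cᵢ≡0)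
                         (trans (label-fromCoeffs c c₀≡0) (trans (sym adᵢ≡c) (sym (label-unit i a))))
                         (subst (InAp d) (sym (label-unit i a)) ((c , adᵢ≡c) , A<B⇒irreducible i bLeast a<b))
                         uniqueLShape

proposition2p10 : (d : Gens) → NumSemigroupEmb4 d → (UniqueLShape d ⇔ AEqualsB d)
proposition2p10 d (minimal , _) =
  mk⇔ (uniqueLShape⇒AEqualsB d d-pos) (AEqualsB⇒uniqueLShape d d-pos)
  where d-pos = minimalGens⇒positive minimal
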